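{- The tree obtained from $\mathcal T_b$ by replacing each permutation $\pi$ by $\mathrm{rev}(\pi)$ coincides with the tree obtained by reflecting $\mathcal T_b$ in a vertical mirror. Equivalently, if the sequence of insertions $(S_1,k_1),\dots,(S_{n-1},k_{n-1})$ (with $S_r\in\{L,R\}$) leads from the root $1$ to $\pi\in\mathcal B_n$ in $\mathcal T_b$, then the sequence $(\bar S_1,k_1),\dots,(\bar S_{n-1},k_{n-1})$, obtained by exchanging $L$ and $R$, leads from $1$ to $\mathrm{rev}(\pi)$.
   Context: $\mathrm{rev}(\pi)=\pi(n)\cdots\pi(1)$. A Baxter permutation is $\pi\in\mathfrak S_n$ with no $i<j<k$ such that $\pi(j+1)<\pi(i)<\pi(k)<\pi(j)$ or $\pi(j)<\pi(k)<\pi(i)<\pi(j+1)$; $\mathcal B_n$ is the set of them. For $\sigma\in\mathcal B_n$ with $i$ left-to-right maxima and $j$ right-to-left maxima, $L_k(\sigma)$ ($1\le k\le i$) is obtained by inserting $n+1$ immediately before the $k$-th left-to-right maximum (counted from the left), and $R_k(\sigma)$ ($1\le k\le j$) by inserting $n+1$ immediately after the $k$-th right-to-left maximum (counted from the right). An $(L,k)$-insertion applies $L_k$, an $(R,k)$-insertion applies $R_k$. $\mathcal T_b$ is the rooted plane tree with root the permutation $1$ in which the children of $\sigma$ are, from left to right, $L_1(\sigma),\dots,L_i(\sigma),R_j(\sigma),\dots,R_1(\sigma)$. -}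

module Defs where

open import Data.Nat using (ℕ; zero; suc; _<ᵇ_; _≤ᵇ_; _≡ᵇ_; _⊔_)
open import Data.Bool using (Bool; true; false; if_then_else_; _∧_)
open import Data.List using (List; []; _∷_; length; foldr; reverse; map)
open import Data.Maybe using (Maybe; just; nothing; _>>=_)
open import Data.Product using (_×_; _,_)

-- A permutation of [n] in one-line notation π(1) ⋯ π(n), as a list of naturals.
Perm : Set
Perm = List ℕ

rev : Perm → Perm
rev = reverse

maxList : List ℕ → ℕ
maxList = foldr _⊔_ 0

-- Left-to-right maxima: number of entries larger than every entry to their left
-- (m is the maximum of the prefix already read; entries are ≥ 1).
lrCountFrom : ℕ → List ℕ → ℕ
lrCountFrom m [] = 0
lrCountFrom m (y ∷ ys) = if m <ᵇ y then suc (lrCountFrom y ys) else lrCountFrom m ys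

lrCount : Perm → ℕ
lrCount = lrCountFrom 0

rlCount : Perm → ℕ
rlCount [] = 0
rlCount (y ∷ ys) = if maxList ys <ᵇ y then suc (rlCount ys) else rlCount ys

-- insert x immediately before the k-th left-to-right maximum (counted from the left);
-- m = maximum of the prefix read so far, k = remaining index (1-based).
insertLFrom : ℕ → ℕ → ℕ → List ℕ → List ℕ
insertLFrom x m k [] = []
insertLFrom x m k (y ∷ ys) =
  if m <ᵇ y
  then (if k ≡ᵇ 1 then x ∷ y ∷ ys else y ∷ insertLFrom x y (Data.Nat.pred k) ys)
  else y ∷ insertLFrom x m k ys

-- insert x immediately after the k-th right-to-left maximum (counted from the right);
-- an entry y followed by ys is an RL maximum iff y > max ys, and then it is the
-- (rlCount ys + 1)-th RL maximum counted from the right.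
insertR : ℕ → ℕ → List ℕ → List ℕ
insertR x k [] = []
insertR x k (y ∷ ys) =
  if (maxList ys <ᵇ y) ∧ (suc (rlCount ys) ≡ᵇ k)
  then y ∷ x ∷ ys
  else y ∷ insertR x k ys

data Side : Set where
  L R : Side

flipSide : Side → Side
flipSide L = R
flipSide R = L

insertion : Side × ℕ → Perm → Maybe Perm
insertion (L , k) σ =
  if (1 ≤ᵇ k) ∧ (k ≤ᵇ lrCount σ) then just (insertLFrom (suc (length σ)) 0 k σ) else nothing
insertion (R , k) σ =
  if (1 ≤ᵇ k) ∧ (k ≤ᵇ rlCount σ) then just (insertR (suc (length σ)) k σ) else nothing

follow : List (Side × ℕ) → Perm → Maybe Perm
follow [] σ = just σ
follow (s ∷ ss) σ = insertion s σ >>= follow ss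

flipIns : Side × ℕ → Side × ℕ
flipIns (S , k) = (flipSide S , k)

root : Perm
root = 1 ∷ []

module Submission where

-- Reading a permutation backwards turns its left-to-right maxima into its
-- right-to-left maxima, and inserting n+1 just before the k-th left-to-right
-- maximum of σ is, read backwards, inserting n+1 just after the k-th
-- right-to-left maximum of rev σ.  So an (S,k)-insertion commutes with rev
-- once S is exchanged with its mirror image, and the theorem follows by
-- induction along the insertion sequence, since rev fixes the root 1.
--
-- Both L-notions (lrCountFrom, insertLFrom) are defined by recursion from the
-- left, the R-notions (rlCount, insertR) from the right.  The key step is to
-- compute the L-notions on a list zs ++ [y] by a rule that has exactly the
-- shape of the defining clause of the R-notions on y ∷ ys (lrCount-snoc,
-- insertL-snoc); then reversal turns one recursion into the other
-- (lrCount-reverse, reverse-insertR).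

open import Defs
open import Data.Nat using (ℕ; zero; suc; _⊔_; _<ᵇ_; _≤ᵇ_; _≡ᵇ_)
open import Data.Nat.Properties
  using (⊔-assoc; ⊔-identityʳ; ⊔-comm; m≤n⇒m⊔n≡n; m≥n⇒m⊔n≡m; <⇒≤; ≮⇒≥; <ᵇ-reflects-<)
open import Data.Bool using (Bool; true; false; if_then_else_; _∧_)
open import Data.Bool.Properties using (if-float; ∧-zeroʳ)
open import Data.List using (List; []; _∷_; _++_; reverse; length; map)
open import Data.List.Properties using (unfold-reverse; reverse-++; reverse-involutive; length-reverse)
open import Data.Maybe using (just; nothing)
import Data.Maybe as Maybe
open import Data.Product using (_×_; _,_)
open import Relation.Binary.PropositionalEquality using (_≡_; refl; sym; trans; cong; cong₂; module ≡-Reasoning)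
open import Relation.Nullary.Reflects using (ofʸ; ofⁿ)
open ≡-Reasoning

runningMax-step : ∀ m z r → m ⊔ (z ⊔ r) ≡ (if m <ᵇ z then z else m) ⊔ r
runningMax-step m z r with m <ᵇ z | <ᵇ-reflects-< m z
... | true  | ofʸ m<z = trans (sym (⊔-assoc m z r)) (cong (_⊔ r) (m≤n⇒m⊔n≡n (<⇒≤ m<z)))
... | false | ofⁿ m≮z = trans (sym (⊔-assoc m z r)) (cong (_⊔ r) (m≥n⇒m⊔n≡m (≮⇒≥ m≮z)))

maxList-++ : ∀ zs ws → maxList (zs ++ ws) ≡ maxList zs ⊔ maxList ws
maxList-++ []       ws = refl
maxList-++ (z ∷ zs) ws = trans (cong (z ⊔_) (maxList-++ zs ws)) (sym (⊔-assoc z _ _))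

maxList-reverse : ∀ ys → maxList (reverse ys) ≡ maxList ys
maxList-reverse []       = refl
maxList-reverse (y ∷ ys) = begin
  maxList (reverse (y ∷ ys))          ≡⟨ cong maxList (unfold-reverse y ys) ⟩
  maxList (reverse ys ++ y ∷ [])      ≡⟨ maxList-++ (reverse ys) (y ∷ []) ⟩
  maxList (reverse ys) ⊔ (y ⊔ 0)      ≡⟨ cong₂ _⊔_ (maxList-reverse ys) (⊔-identityʳ y) ⟩
  maxList ys ⊔ y                      ≡⟨ ⊔-comm (maxList ys) y ⟩
  y ⊔ maxList ys                      ∎

-- Counting left-to-right maxima of zs ++ [y]: the last entry y is a new one
-- iff it exceeds everything before it (the analogue of the cons-clause of
-- rlCount).
lrCount-snoc : ∀ m zs y →
  lrCountFrom m (zs ++ y ∷ []) ≡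
  (if m ⊔ maxList zs <ᵇ y then suc (lrCountFrom m zs) else lrCountFrom m zs)
lrCount-snoc m [] y rewrite ⊔-identityʳ m with m <ᵇ y
... | true  = refl
... | false = refl
lrCount-snoc m (z ∷ zs) y rewrite runningMax-step m z (maxList zs) with m <ᵇ z
... | true  = trans (cong suc (lrCount-snoc z zs y)) (if-float suc (z ⊔ maxList zs <ᵇ y))
... | false = lrCount-snoc m zs y

lrCount-reverse : ∀ ys → lrCount (reverse ys) ≡ rlCount ys
lrCount-reverse []       = refl
lrCount-reverse (y ∷ ys) = begin
  lrCount (reverse (y ∷ ys))                      ≡⟨ cong lrCount (unfold-reverse y ys) ⟩
  lrCountFrom 0 (reverse ys ++ y ∷ [])            ≡⟨ lrCount-snoc 0 (reverse ys) y ⟩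
  (if maxList (reverse ys) <ᵇ y then suc (lrCount (reverse ys)) else lrCount (reverse ys))
    ≡⟨ cong₂ (λ a c → if a <ᵇ y then suc c else c) (maxList-reverse ys) (lrCount-reverse ys) ⟩
  rlCount (y ∷ ys)                                ∎

rlCount-reverse : ∀ σ → rlCount (reverse σ) ≡ lrCount σ
rlCount-reverse σ = begin
  rlCount (reverse σ)                 ≡⟨ lrCount-reverse (reverse σ) ⟨
  lrCount (reverse (reverse σ))       ≡⟨ cong lrCount (reverse-involutive σ) ⟩
  lrCount σ                           ∎

-- This is the mirror image of the defining clause of insertR.
insertL-snoc : ∀ x m k zs y →
  insertLFrom x m k (zs ++ y ∷ []) ≡
  (if (m ⊔ maxList zs <ᵇ y) ∧ (suc (lrCountFrom m zs) ≡ᵇ k)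
   then zs ++ x ∷ y ∷ []
   else insertLFrom x m k zs ++ y ∷ [])
insertL-snoc x m k [] y rewrite ⊔-identityʳ m with m <ᵇ y | k
... | false | _           = refl
... | true  | zero        = refl
... | true  | suc zero    = refl
... | true  | suc (suc _) = refl
insertL-snoc x m k (z ∷ zs) y rewrite runningMax-step m z (maxList zs) with m <ᵇ z | k
... | false | k′          = trans (cong (z ∷_) (insertL-snoc x m k′ zs y)) (if-float (z ∷_) _)
... | true  | zero        = trans (cong (z ∷_) (insertL-snoc x z 0 zs y)) (if-float (z ∷_) _)
... | true  | suc zero    rewrite ∧-zeroʳ (z ⊔ maxList zs <ᵇ y) = refl
... | true  | suc (suc k) = trans (cong (z ∷_) (insertL-snoc x z (suc k) zs y)) (if-float (z ∷_) _)

-- Reading an R-insertion backwards gives the L-insertion with the same index: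
-- induction on ys, comparing the cons-clause of insertR with insertL-snoc.
reverse-insertR : ∀ x k ys → reverse (insertR x k ys) ≡ insertLFrom x 0 k (reverse ys)
reverse-insertR x k []       = refl
reverse-insertR x k (y ∷ ys) = begin
  reverse (if isKth then y ∷ x ∷ ys else y ∷ insertR x k ys)
    ≡⟨ if-float reverse isKth ⟩
  (if isKth then reverse (y ∷ x ∷ ys) else reverse (y ∷ insertR x k ys))
    ≡⟨ cong₂ (if isKth then_else_) (reverse-++ (y ∷ x ∷ []) ys) (unfold-reverse y (insertR x k ys)) ⟩
  (if isKth then reverse ys ++ x ∷ y ∷ [] else reverse (insertR x k ys) ++ y ∷ [])
    ≡⟨ cong (λ t → if isKth then reverse ys ++ x ∷ y ∷ [] else t ++ y ∷ []) (reverse-insertR x k ys) ⟩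
  (if isKth then reverse ys ++ x ∷ y ∷ [] else insertLFrom x 0 k (reverse ys) ++ y ∷ [])
    ≡⟨ cong₂ (λ a c → if (a <ᵇ y) ∧ (suc c ≡ᵇ k) then reverse ys ++ x ∷ y ∷ []
                      else insertLFrom x 0 k (reverse ys) ++ y ∷ [])
             (sym (maxList-reverse ys)) (sym (lrCount-reverse ys)) ⟩
  (if (maxList (reverse ys) <ᵇ y) ∧ (suc (lrCount (reverse ys)) ≡ᵇ k)
   then reverse ys ++ x ∷ y ∷ [] else insertLFrom x 0 k (reverse ys) ++ y ∷ [])
    ≡⟨ insertL-snoc x 0 k (reverse ys) y ⟨
  insertLFrom x 0 k (reverse ys ++ y ∷ [])
    ≡⟨ cong (insertLFrom x 0 k) (unfold-reverse y ys) ⟨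
  insertLFrom x 0 k (reverse (y ∷ ys)) ∎
  where
  isKth : Bool
  isKth = (maxList ys <ᵇ y) ∧ (suc (rlCount ys) ≡ᵇ k)

reverse-insertL : ∀ x k σ → reverse (insertLFrom x 0 k σ) ≡ insertR x k (reverse σ)
reverse-insertL x k σ = begin
  reverse (insertLFrom x 0 k σ)                       ≡⟨ cong (λ τ → reverse (insertLFrom x 0 k τ)) (reverse-involutive σ) ⟨
  reverse (insertLFrom x 0 k (reverse (reverse σ)))   ≡⟨ cong reverse (reverse-insertR x k (reverse σ)) ⟨
  reverse (reverse (insertR x k (reverse σ)))         ≡⟨ reverse-involutive _ ⟩
  insertR x k (reverse σ)                             ∎

insertion-flip : ∀ s σ → insertion (flipIns s) (rev σ) ≡ Maybe.map rev (insertion s σ)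
insertion-flip (L , k) σ
  rewrite rlCount-reverse σ | length-reverse σ | sym (reverse-insertL (suc (length σ)) k σ)
  with (1 ≤ᵇ k) ∧ (k ≤ᵇ lrCount σ)
... | true  = refl
... | false = refl
insertion-flip (R , k) σ
  rewrite lrCount-reverse σ | length-reverse σ | sym (reverse-insertR (suc (length σ)) k σ)
  with (1 ≤ᵇ k) ∧ (k ≤ᵇ rlCount σ)
... | true  = refl
... | false = refl

follow-flip : ∀ ss σ → follow (map flipIns ss) (rev σ) ≡ Maybe.map rev (follow ss σ)
follow-flip []       σ = refl
follow-flip (s ∷ ss) σ rewrite insertion-flip s σ with insertion s σ
... | nothing = refl
... | just τ  = follow-flip ss τ

proposition4p2 : (ss : List (Side × ℕ)) (π : Perm) →
    follow ss root ≡ just π →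
    follow (map flipIns ss) root ≡ just (rev π)
proposition4p2 ss π reaches-π = begin
  follow (map flipIns ss) (rev root)   ≡⟨ follow-flip ss root ⟩
  Maybe.map rev (follow ss root)       ≡⟨ cong (Maybe.map rev) reaches-π ⟩
  just (rev π)                         ∎
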